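{- (a) The only integer matrices in $P(m,n)$ are the $m\times n$ sign matrices. (b) For a partition $\lambda$ and positive integer $n$, the only integer matrices in $P(\lambda,n)$ are the matrices in $M(\lambda,n)$. (c) The only integer matrices in $ASM_n$ are the $n\times n$ alternating sign matrices.
   Context: A sign matrix is a matrix with entries in $\{ -1,0,1\}$ whose column partial sums from the top lie in $\{0,1\}$ and whose row partial sums from the left are nonnegative; $P(m,n)$ is the convex hull in $\mathbb{R}^{mn}$ of all $m\times n$ sign matrices. For a partition $\lambda=[\lambda_1,\ldots,\lambda_k]$ with $a_i$ the number of parts equal to $i$, $M(\lambda,n)$ is the set of $\lambda_1\times n$ sign matrices whose $i$-th row sums to $a_{\lambda_1-i+1}$, and $P(\lambda,n)$ is its convex hull in $\mathbb{R}^{\lambda_1 n}$. An alternating sign matrix is a square matrix with entries in $\{ -1,0,1\}$ whose rows and columns each sum to $1$ and whose nonzero entries alternate in sign along every row and column; $ASM_n$ is the convex hull in $\mathbb{R}^{n^2}$ of all $n\times n$ alternating sign matrices.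
   Formalization: The convex hulls $P(m,n)$, $P(\lambda,n)$ and $ASM_n$ are formed from convex combinations with rational weights only, in place of real convex combinations. -}

module Defs where

open import Data.Nat as ℕ using (ℕ; zero; suc)
open import Data.Integer as ℤ using (ℤ; +_; -[1+_])
open import Data.Rational as ℚ using (ℚ; 0ℚ; 1ℚ)
open import Data.Fin using (Fin; toℕ)
open import Data.List using (List; []; _∷_; foldr; map; length; filter)
open import Data.List.Relation.Unary.All using (All)
open import Data.List.Relation.Unary.Linked using (Linked)
open import Data.Product using (Σ; _×_; _,_; proj₁; proj₂; ∃)
open import Data.Sum using (_⊎_)
open import Relation.Binary.PropositionalEquality using (_≡_; _≢_)
open import Relation.Nullary using (¬_)

IMat : ℕ → ℕ → Set
IMat m n = Fin m → Fin n → ℤ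

QMat : ℕ → ℕ → Set
QMat m n = Fin m → Fin n → ℚ

toQ : ∀ {m n} → IMat m n → QMat m n
toQ A i j = A i j ℚ./ 1

sumℤ : ∀ {n} → (Fin n → ℤ) → ℤ
sumℤ {zero}  f = + 0
sumℤ {suc n} f = f Fin.zero ℤ.+ sumℤ (λ i → f (Fin.suc i))

psum : ∀ {n} → ℕ → (Fin n → ℤ) → ℤ
psum k f = sumℤ (λ i → if< (toℕ i) k (f i))
  where
  if< : ℕ → ℕ → ℤ → ℤ
  if< a b z with a ℕ.<? b
  ... | Relation.Nullary.yes _ = z
  ... | Relation.Nullary.no _  = + 0

IsSign : ℤ → Set
IsSign z = (z ≡ -[1+ 0 ]) ⊎ ((z ≡ + 0) ⊎ (z ≡ + 1))

IsSignMatrix : ∀ {m n} → IMat m n → Set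
IsSignMatrix {m} {n} A =
  (∀ i j → IsSign (A i j)) ×
  ((j : Fin n) (k : Fin m) →
     let s = psum (suc (toℕ k)) (λ i → A i j) in (s ≡ + 0) ⊎ (s ≡ + 1)) ×
  ((i : Fin m) (k : Fin n) → + 0 ℤ.≤ psum (suc (toℕ k)) (A i))

sumℚ : List ℚ → ℚ
sumℚ = foldr ℚ._+_ 0ℚ

InConvexHull : ∀ {m n} → (IMat m n → Set) → QMat m n → Set
InConvexHull {m} {n} S X =
  Σ (List (ℚ × IMat m n)) λ comb →
    All (λ p → (0ℚ ℚ.≤ proj₁ p) × S (proj₂ p)) comb ×
    (sumℚ (map proj₁ comb) ≡ 1ℚ) ×
    (∀ i j → X i j ≡ sumℚ (map (λ p → proj₁ p ℚ.* toQ (proj₂ p) i j) comb))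

InP : ∀ m n → QMat m n → Set
InP m n = InConvexHull {m} {n} IsSignMatrix

IsPartition : List ℕ → Set
IsPartition λs = All (λ x → 1 ℕ.≤ x) λs × Linked ℕ._≥_ λs

largestPart : List ℕ → ℕ
largestPart []      = 0
largestPart (x ∷ _) = x

-- a_i = number of parts equal to i
mult : List ℕ → ℕ → ℕ
mult λs i = length (filter (ℕ._≟ i) λs)

-- M(λ,n): λ₁ × n sign matrices whose i-th row (1-indexed) sums to a_{λ₁-i+1};
-- with 0-indexed row r this is a_{λ₁ - r}.
InM : (λs : List ℕ) (n : ℕ) → IMat (largestPart λs) n → Set
InM λs n A = IsSignMatrix A ×
  ((r : Fin (largestPart λs)) → sumℤ (A r) ≡ + mult λs (largestPart λs ℕ.∸ toℕ r))

InPλ : (λs : List ℕ) (n : ℕ) → QMat (largestPart λs) n → Set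
InPλ λs n = InConvexHull {largestPart λs} {n} (InM λs n)

IsASM : ∀ {n} → IMat n n → Set
IsASM {n} A =
  (∀ i j → IsSign (A i j)) ×
  (∀ i → sumℤ (A i) ≡ + 1) ×
  (∀ j → sumℤ (λ i → A i j) ≡ + 1) ×
  (∀ i (j k : Fin n) → toℕ j ℕ.< toℕ k → A i j ≢ + 0 → A i k ≢ + 0 →
     (∀ (l : Fin n) → toℕ j ℕ.< toℕ l → toℕ l ℕ.< toℕ k → A i l ≡ + 0) →
     A i j ℤ.+ A i k ≡ + 0) ×
  (∀ j (i k : Fin n) → toℕ i ℕ.< toℕ k → A i j ≢ + 0 → A k j ≢ + 0 →
     (∀ (l : Fin n) → toℕ i ℕ.< toℕ l → toℕ l ℕ.< toℕ k → A l j ≡ + 0) →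
     A i j ℤ.+ A k j ≡ + 0)

InASMpoly : ∀ n → QMat n n → Set
InASMpoly n = InConvexHull {n} {n} IsASM

-- A point of a convex hull is a weighted average of the vertices, so any bound that holds for an
-- integer-valued linear functional (an entry, a row or column sum, a partial sum) on every vertex
-- also holds at the point.  At an integer matrix the functional takes an integer value, and the
-- bounds -1 ≤ x ≤ 1, 0 ≤ x ≤ 1, 0 ≤ x and c ≤ x ≤ c then say x ∈ {-1,0,1}, x ∈ {0,1}, x ≥ 0 and
-- x = c.  This covers every defining condition of sign matrices and of M(λ,n), and the entries
-- and line sums of alternating sign matrices.  Alternation is not linear, but a line of
-- entries in {-1,0,1} summing to 1 alternates iff all of its partial sums lie in {0,1}.
module Submission where

open import Defs
open import Algebra.Bundles using (CommutativeMonoid)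
open import Data.Nat as ℕ using (ℕ; zero; suc; z≤n; s≤s; _≤_; _<_)
import Data.Nat.Properties as ℕP
open import Data.Integer as ℤ using (ℤ; +_; -[1+_]; _+_; -≤+; +≤+; -≤-)
import Data.Integer.Properties as ℤP
open import Data.Rational as ℚ using (ℚ; 0ℚ; 1ℚ; _/_)
import Data.Rational.Properties as ℚP
open import Data.Rational.Unnormalised as ℚᵘ using (mkℚᵘ)
import Data.Rational.Unnormalised.Properties as ℚᵘP
open import Data.Fin using (Fin; toℕ; fromℕ<)
import Data.Fin.Properties as FinP
open import Data.List using (List; []; _∷_; map)
open import Data.List.Properties using (map-cong)
open import Data.List.Relation.Unary.All using (All; []; _∷_)
open import Data.Product using (Σ-syntax; _×_; _,_; proj₁; proj₂)
open import Data.Sum using (_⊎_; inj₁; inj₂)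
open import Data.Empty using (⊥-elim)
open import Function using (_∘_)
open import Relation.Binary.PropositionalEquality
open import Relation.Nullary using (yes; no)
open import Algebra.Properties.CommutativeSemigroup
  (CommutativeMonoid.commutativeSemigroup ℚP.+-0-commutativeMonoid) using (interchange)

toℚᵘ-/1 : ∀ z → ℚ.toℚᵘ (z / 1) ℚᵘ.≃ mkℚᵘ z 0
toℚᵘ-/1 z = ℚP.toℚᵘ-fromℚᵘ (mkℚᵘ z 0)

/1-mono-≤ : ∀ {a b} → a ℤ.≤ b → a / 1 ℚ.≤ b / 1
/1-mono-≤ {a} {b} a≤b = ℚP.toℚᵘ-cancel-≤
  (ℚᵘP.≤-respˡ-≃ (ℚᵘP.≃-sym (toℚᵘ-/1 a)) (ℚᵘP.≤-respʳ-≃ (ℚᵘP.≃-sym (toℚᵘ-/1 b))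
    (ℚᵘ.*≤* (subst₂ ℤ._≤_ (sym (ℤP.*-identityʳ a)) (sym (ℤP.*-identityʳ b)) a≤b))))

/1-cancel-≤ : ∀ {a b} → a / 1 ℚ.≤ b / 1 → a ℤ.≤ b
/1-cancel-≤ {a} {b} a≤b
  with ℚᵘP.≤-respˡ-≃ (toℚᵘ-/1 a) (ℚᵘP.≤-respʳ-≃ (toℚᵘ-/1 b) (ℚP.toℚᵘ-mono-≤ a≤b))
... | ℚᵘ.*≤* a*1≤b*1 = subst₂ ℤ._≤_ (ℤP.*-identityʳ a) (ℤP.*-identityʳ b) a*1≤b*1

/1-homo-+ : ∀ a b → (a + b) / 1 ≡ a / 1 ℚ.+ b / 1
/1-homo-+ a b = ℚP.toℚᵘ-injective (begin
  ℚ.toℚᵘ ((a + b) / 1)                  ≈⟨ toℚᵘ-/1 (a + b) ⟩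
  mkℚᵘ (a + b) 0                        ≈⟨ ℚᵘ.*≡* (cong₂ (λ x y → (x + y) ℤ.* + 1)
                                             (sym (ℤP.*-identityʳ a)) (sym (ℤP.*-identityʳ b))) ⟩
  mkℚᵘ a 0 ℚᵘ.+ mkℚᵘ b 0                ≈⟨ ℚᵘP.+-cong (toℚᵘ-/1 a) (toℚᵘ-/1 b) ⟨
  ℚ.toℚᵘ (a / 1) ℚᵘ.+ ℚ.toℚᵘ (b / 1)    ≈⟨ ℚP.toℚᵘ-homo-+ (a / 1) (b / 1) ⟨
  ℚ.toℚᵘ (a / 1 ℚ.+ b / 1)              ∎)
  where open ℚᵘP.≃-Reasoning

module _ {B : Set} where

  weightedSum : List (ℚ × B) → (B → ℚ) → ℚ
  weightedSum comb f = sumℚ (map (λ p → proj₁ p ℚ.* f (proj₂ p)) comb)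

  weightedSum-cong : ∀ comb {f g : B → ℚ} → f ≗ g → weightedSum comb f ≡ weightedSum comb g
  weightedSum-cong comb f≗g = cong sumℚ (map-cong (λ p → cong (proj₁ p ℚ.*_) (f≗g (proj₂ p))) comb)

  weightedSum-zero : ∀ comb → weightedSum comb (λ _ → 0ℚ) ≡ 0ℚ
  weightedSum-zero []               = refl
  weightedSum-zero ((w , _) ∷ comb) =
    trans (cong₂ ℚ._+_ (ℚP.*-zeroʳ w) (weightedSum-zero comb)) (ℚP.+-identityʳ 0ℚ)

  weightedSum-+ : ∀ comb (f g : B → ℚ) →
                  weightedSum comb (λ b → f b ℚ.+ g b) ≡ weightedSum comb f ℚ.+ weightedSum comb g
  weightedSum-+ []               f g = sym (ℚP.+-identityʳ 0ℚ)
  weightedSum-+ ((w , b) ∷ comb) f g = begin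
    w ℚ.* (f b ℚ.+ g b) ℚ.+ weightedSum comb (λ b → f b ℚ.+ g b)
      ≡⟨ cong₂ ℚ._+_ (ℚP.*-distribˡ-+ w (f b) (g b)) (weightedSum-+ comb f g) ⟩
    (w ℚ.* f b ℚ.+ w ℚ.* g b) ℚ.+ (weightedSum comb f ℚ.+ weightedSum comb g)
      ≡⟨ interchange (w ℚ.* f b) (w ℚ.* g b) (weightedSum comb f) (weightedSum comb g) ⟩
    (w ℚ.* f b ℚ.+ weightedSum comb f) ℚ.+ (w ℚ.* g b ℚ.+ weightedSum comb g)
      ∎
    where open ≡-Reasoning

  SupportedIn : (B → Set) → List (ℚ × B) → Set
  SupportedIn S = All (λ p → 0ℚ ℚ.≤ proj₁ p × S (proj₂ p))

  weights : List (ℚ × B) → ℚ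
  weights comb = sumℚ (map proj₁ comb)

  module _ {S : B → Set} {c : ℚ} {f : B → ℚ} where

    weightedSum-≥ : ∀ {comb} → SupportedIn S comb → (∀ b → S b → c ℚ.≤ f b) →
                    c ℚ.* weights comb ℚ.≤ weightedSum comb f
    weightedSum-≥ []                                   c≤f = ℚP.≤-reflexive (ℚP.*-zeroʳ c)
    weightedSum-≥ {(w , b) ∷ comb} ((0≤w , b∈S) ∷ sup) c≤f = begin
      c ℚ.* (w ℚ.+ weights comb)               ≡⟨ ℚP.*-distribˡ-+ c w (weights comb) ⟩
      c ℚ.* w ℚ.+ c ℚ.* weights comb           ≡⟨ cong (ℚ._+ c ℚ.* weights comb) (ℚP.*-comm c w) ⟩
      w ℚ.* c ℚ.+ c ℚ.* weights comb           ≤⟨ ℚP.+-mono-≤ (ℚP.*-monoˡ-≤-nonNeg w {{ℚ.nonNegative 0≤w}}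
                                                                                   (c≤f b b∈S))
                                                                (weightedSum-≥ sup c≤f) ⟩
      w ℚ.* f b ℚ.+ weightedSum comb f         ∎
      where open ℚP.≤-Reasoning

    weightedSum-≤ : ∀ {comb} → SupportedIn S comb → (∀ b → S b → f b ℚ.≤ c) →
                    weightedSum comb f ℚ.≤ c ℚ.* weights comb
    weightedSum-≤ []                                   f≤c = ℚP.≤-reflexive (sym (ℚP.*-zeroʳ c))
    weightedSum-≤ {(w , b) ∷ comb} ((0≤w , b∈S) ∷ sup) f≤c = begin
      w ℚ.* f b ℚ.+ weightedSum comb f         ≤⟨ ℚP.+-mono-≤ (ℚP.*-monoˡ-≤-nonNeg w {{ℚ.nonNegative 0≤w}}
                                                                                   (f≤c b b∈S))
                                                                (weightedSum-≤ sup f≤c) ⟩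
      w ℚ.* c ℚ.+ c ℚ.* weights comb           ≡⟨ cong (ℚ._+ c ℚ.* weights comb) (ℚP.*-comm w c) ⟩
      c ℚ.* w ℚ.+ c ℚ.* weights comb           ≡⟨ ℚP.*-distribˡ-+ c w (weights comb) ⟨
      c ℚ.* (w ℚ.+ weights comb)               ∎
      where open ℚP.≤-Reasoning

Bit : ℤ → Set
Bit z = (z ≡ + 0) ⊎ (z ≡ + 1)

sign-≥ : ∀ {x} → IsSign x → -[1+ 0 ] ℤ.≤ x
sign-≥ (inj₁ refl)        = ℤP.≤-refl
sign-≥ (inj₂ (inj₁ refl)) = -≤+
sign-≥ (inj₂ (inj₂ refl)) = -≤+

sign-≤ : ∀ {x} → IsSign x → x ℤ.≤ + 1
sign-≤ (inj₁ refl)        = -≤+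
sign-≤ (inj₂ (inj₁ refl)) = +≤+ z≤n
sign-≤ (inj₂ (inj₂ refl)) = ℤP.≤-refl

bit-≥ : ∀ {x} → Bit x → + 0 ℤ.≤ x
bit-≥ (inj₁ refl) = ℤP.≤-refl
bit-≥ (inj₂ refl) = +≤+ z≤n

bit-≤ : ∀ {x} → Bit x → x ℤ.≤ + 1
bit-≤ (inj₁ refl) = +≤+ z≤n
bit-≤ (inj₂ refl) = ℤP.≤-refl

bounds⇒sign : ∀ {x} → -[1+ 0 ] ℤ.≤ x → x ℤ.≤ + 1 → IsSign x
bounds⇒sign { -[1+ 0 ]}       _          _                  = inj₁ refl
bounds⇒sign { -[1+ suc _ ]}   (-≤- ())   _
bounds⇒sign { + 0}            _          _                  = inj₂ (inj₁ refl)
bounds⇒sign { + 1}            _          _                  = inj₂ (inj₂ refl)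
bounds⇒sign { + suc (suc _)}  _          (+≤+ (s≤s ()))

bounds⇒bit : ∀ {x} → + 0 ℤ.≤ x → x ℤ.≤ + 1 → Bit x
bounds⇒bit { -[1+ _ ]}       ()  _
bounds⇒bit { + 0}            _   _                = inj₁ refl
bounds⇒bit { + 1}            _   _                = inj₂ refl
bounds⇒bit { + suc (suc _)}  _   (+≤+ (s≤s ()))

sumℤ-cong : ∀ {n} {f g : Fin n → ℤ} → f ≗ g → sumℤ f ≡ sumℤ g
sumℤ-cong {zero}  f≗g = refl
sumℤ-cong {suc n} f≗g = cong₂ _+_ (f≗g Fin.zero) (sumℤ-cong (f≗g ∘ Fin.suc))

sumℤ-zero : ∀ n → sumℤ {n} (λ _ → + 0) ≡ + 0
sumℤ-zero zero    = refl
sumℤ-zero (suc n) = trans (ℤP.+-identityˡ _) (sumℤ-zero n)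

-- The summand of psum is local to Defs; unification recovers it as a term we can name.
psum-as-sumℤ : ∀ {n} k (v : Fin n → ℤ) → Σ[ u ∈ (Fin n → ℤ) ] psum k v ≡ sumℤ u
psum-as-sumℤ k v = _ , refl

truncate : ∀ {n} → ℕ → (Fin n → ℤ) → Fin n → ℤ
truncate k v = proj₁ (psum-as-sumℤ k v)

truncate-< : ∀ {n k} (v : Fin n → ℤ) i → toℕ i < k → truncate k v i ≡ v i
truncate-< {k = k} v i i<k with toℕ i ℕ.<? k
... | yes _   = refl
... | no  i≮k = ⊥-elim (i≮k i<k)

truncate-≥ : ∀ {n k} (v : Fin n → ℤ) i → k ≤ toℕ i → truncate k v i ≡ + 0
truncate-≥ {k = k} v i k≤i with toℕ i ℕ.<? k
... | yes i<k = ⊥-elim (ℕP.<⇒≱ i<k k≤i)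
... | no _    = refl

psum-zero : ∀ {n} (v : Fin n → ℤ) → psum 0 v ≡ + 0
psum-zero {n} v = trans (sumℤ-cong (λ i → truncate-≥ v i z≤n)) (sumℤ-zero n)

psum-suc : ∀ {n} k (v : Fin (suc n) → ℤ) → psum (suc k) v ≡ v Fin.zero + psum k (v ∘ Fin.suc)
psum-suc k v = cong₂ _+_ (truncate-< {k = suc k} v Fin.zero (s≤s z≤n)) (sumℤ-cong shift)
  where
  shift : ∀ i → truncate (suc k) v (Fin.suc i) ≡ truncate k (v ∘ Fin.suc) i
  shift i with ℕP.<-≤-connex (toℕ i) k
  ... | inj₁ i<k = trans (truncate-< v (Fin.suc i) (s≤s i<k)) (sym (truncate-< (v ∘ Fin.suc) i i<k))
  ... | inj₂ k≤i = trans (truncate-≥ v (Fin.suc i) (s≤s k≤i)) (sym (truncate-≥ (v ∘ Fin.suc) i k≤i))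

psum-total : ∀ {n} (v : Fin n → ℤ) → psum n v ≡ sumℤ v
psum-total {zero}  v = refl
psum-total {suc n} v = trans (psum-suc n v) (cong (_+_ (v Fin.zero)) (psum-total (v ∘ Fin.suc)))

psum-step : ∀ {n} (v : Fin n → ℤ) p → psum (suc (toℕ p)) v ≡ psum (toℕ p) v + v p
psum-step v Fin.zero = begin
  psum 1 v                            ≡⟨ psum-suc 0 v ⟩
  v Fin.zero + psum 0 (v ∘ Fin.suc)   ≡⟨ cong (_+_ (v Fin.zero)) (psum-zero (v ∘ Fin.suc)) ⟩
  v Fin.zero + + 0                    ≡⟨ ℤP.+-comm (v Fin.zero) (+ 0) ⟩
  + 0 + v Fin.zero                    ≡⟨ cong (_+ v Fin.zero) (psum-zero v) ⟨
  psum 0 v + v Fin.zero               ∎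
  where open ≡-Reasoning
psum-step v (Fin.suc p) = begin
  psum (suc (suc (toℕ p))) v
    ≡⟨ psum-suc (suc (toℕ p)) v ⟩
  v Fin.zero + psum (suc (toℕ p)) (v ∘ Fin.suc)
    ≡⟨ cong (_+_ (v Fin.zero)) (psum-step (v ∘ Fin.suc) p) ⟩
  v Fin.zero + (psum (toℕ p) (v ∘ Fin.suc) + v (Fin.suc p))
    ≡⟨ ℤP.+-assoc (v Fin.zero) _ _ ⟨
  (v Fin.zero + psum (toℕ p) (v ∘ Fin.suc)) + v (Fin.suc p)
    ≡⟨ cong (_+ v (Fin.suc p)) (psum-suc (toℕ p) v) ⟨
  psum (suc (toℕ p)) v + v (Fin.suc p)
    ∎
  where open ≡-Reasoning

psum-zeros : ∀ {n} (v : Fin n → ℤ) {l₀ l₁} → l₀ ≤ l₁ →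
             (∀ i → l₀ ≤ toℕ i → toℕ i < l₁ → v i ≡ + 0) → psum l₁ v ≡ psum l₀ v
psum-zeros {zero}  v _ _ = refl
psum-zeros {suc n} v {zero} {zero} _ _ = refl
psum-zeros {suc n} v {zero} {suc l₁} _ zeros = begin
  psum (suc l₁) v                       ≡⟨ psum-suc l₁ v ⟩
  v Fin.zero + psum l₁ (v ∘ Fin.suc)    ≡⟨ cong₂ _+_ (zeros Fin.zero z≤n (s≤s z≤n))
                                                     (psum-zeros (v ∘ Fin.suc) z≤n tail-zeros) ⟩
  + 0 + psum 0 (v ∘ Fin.suc)            ≡⟨ cong (_+_ (+ 0)) (psum-zero (v ∘ Fin.suc)) ⟩
  + 0                                   ≡⟨ psum-zero v ⟨
  psum 0 v                              ∎
  where
  open ≡-Reasoning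
  tail-zeros : ∀ i → 0 ≤ toℕ i → toℕ i < l₁ → v (Fin.suc i) ≡ + 0
  tail-zeros i _ i<l₁ = zeros (Fin.suc i) z≤n (s≤s i<l₁)
psum-zeros {suc n} v {suc l₀} {suc l₁} (s≤s l₀≤l₁) zeros = begin
  psum (suc l₁) v                       ≡⟨ psum-suc l₁ v ⟩
  v Fin.zero + psum l₁ (v ∘ Fin.suc)    ≡⟨ cong (_+_ (v Fin.zero)) (psum-zeros (v ∘ Fin.suc) l₀≤l₁ tail-zeros) ⟩
  v Fin.zero + psum l₀ (v ∘ Fin.suc)    ≡⟨ psum-suc l₀ v ⟨
  psum (suc l₀) v                       ∎
  where
  open ≡-Reasoning
  tail-zeros : ∀ i → l₀ ≤ toℕ i → toℕ i < l₁ → v (Fin.suc i) ≡ + 0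
  tail-zeros i l₀≤i i<l₁ = zeros (Fin.suc i) (s≤s l₀≤i) (s≤s i<l₁)

module Averaging {B : Set} {S : B → Set} {comb : List (ℚ × B)}
                 (supported : SupportedIn S comb) (total : weights comb ≡ 1ℚ) (a : B) where

  record Averaged (ℓ : B → ℤ) : Set where
    constructor averaged
    field
      value≡weightedSum : ℓ a / 1 ≡ weightedSum comb (λ b → ℓ b / 1)

  averaged-zero : Averaged (λ _ → + 0)
  averaged-zero = averaged (sym (weightedSum-zero comb))

  averaged-+ : ∀ {ℓ₁ ℓ₂} → Averaged ℓ₁ → Averaged ℓ₂ → Averaged (λ b → ℓ₁ b + ℓ₂ b)
  averaged-+ {ℓ₁} {ℓ₂} (averaged avg₁) (averaged avg₂) = averaged (begin
    (ℓ₁ a + ℓ₂ a) / 1                                                   ≡⟨ /1-homo-+ (ℓ₁ a) (ℓ₂ a) ⟩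
    ℓ₁ a / 1 ℚ.+ ℓ₂ a / 1                                               ≡⟨ cong₂ ℚ._+_ avg₁ avg₂ ⟩
    weightedSum comb (λ b → ℓ₁ b / 1) ℚ.+ weightedSum comb (λ b → ℓ₂ b / 1)
      ≡⟨ weightedSum-+ comb (λ b → ℓ₁ b / 1) (λ b → ℓ₂ b / 1) ⟨
    weightedSum comb (λ b → ℓ₁ b / 1 ℚ.+ ℓ₂ b / 1)
      ≡⟨ weightedSum-cong comb (λ b → /1-homo-+ (ℓ₁ b) (ℓ₂ b)) ⟨
    weightedSum comb (λ b → (ℓ₁ b + ℓ₂ b) / 1)                          ∎)
    where open ≡-Reasoning

  averaged-sumℤ : ∀ {n} {ℓ : Fin n → B → ℤ} → (∀ i → Averaged (ℓ i)) →
                  Averaged (λ b → sumℤ (λ i → ℓ i b))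
  averaged-sumℤ {zero}  avg = averaged-zero
  averaged-sumℤ {suc n} avg = averaged-+ (avg Fin.zero) (averaged-sumℤ (avg ∘ Fin.suc))

  averaged-psum : ∀ {n} k {ℓ : Fin n → B → ℤ} → (∀ i → Averaged (ℓ i)) →
                  Averaged (λ b → psum k (λ i → ℓ i b))
  averaged-psum k {ℓ} avg = averaged-sumℤ averaged-truncate
    where
    averaged-truncate : ∀ i → Averaged (λ b → truncate k (λ j → ℓ j b) i)
    averaged-truncate i with toℕ i ℕ.<? k
    ... | yes _ = avg i
    ... | no _  = averaged-zero

  averaged-≥ : ∀ {ℓ c} → Averaged ℓ → (∀ b → S b → c ℤ.≤ ℓ b) → c ℤ.≤ ℓ a
  averaged-≥ {ℓ} {c} (averaged avg) c≤ℓ = /1-cancel-≤ (begin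
    c / 1                                    ≡⟨ ℚP.*-identityʳ (c / 1) ⟨
    c / 1 ℚ.* 1ℚ                             ≡⟨ cong (c / 1 ℚ.*_) total ⟨
    c / 1 ℚ.* weights comb                   ≤⟨ weightedSum-≥ supported (λ b b∈S → /1-mono-≤ (c≤ℓ b b∈S)) ⟩
    weightedSum comb (λ b → ℓ b / 1)         ≡⟨ avg ⟨
    ℓ a / 1                                  ∎)
    where open ℚP.≤-Reasoning

  averaged-≤ : ∀ {ℓ c} → Averaged ℓ → (∀ b → S b → ℓ b ℤ.≤ c) → ℓ a ℤ.≤ c
  averaged-≤ {ℓ} {c} (averaged avg) ℓ≤c = /1-cancel-≤ (begin
    ℓ a / 1                                  ≡⟨ avg ⟩
    weightedSum comb (λ b → ℓ b / 1)         ≤⟨ weightedSum-≤ supported (λ b b∈S → /1-mono-≤ (ℓ≤c b b∈S)) ⟩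
    c / 1 ℚ.* weights comb                   ≡⟨ cong (c / 1 ℚ.*_) total ⟩
    c / 1 ℚ.* 1ℚ                             ≡⟨ ℚP.*-identityʳ (c / 1) ⟩
    c / 1                                    ∎)
    where open ℚP.≤-Reasoning

  averaged-≡ : ∀ {ℓ c} → Averaged ℓ → (∀ b → S b → ℓ b ≡ c) → ℓ a ≡ c
  averaged-≡ avg ℓ≡c = ℤP.≤-antisym (averaged-≤ avg (λ b → ℤP.≤-reflexive ∘ ℓ≡c b))
                                    (averaged-≥ avg (λ b → ℤP.≤-reflexive ∘ sym ∘ ℓ≡c b))

  averaged-sign : ∀ {ℓ} → Averaged ℓ → (∀ b → S b → IsSign (ℓ b)) → IsSign (ℓ a)
  averaged-sign avg sign = bounds⇒sign (averaged-≥ avg (λ b → sign-≥ ∘ sign b))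
                                       (averaged-≤ avg (λ b → sign-≤ ∘ sign b))

  averaged-bit : ∀ {ℓ} → Averaged ℓ → (∀ b → S b → Bit (ℓ b)) → Bit (ℓ a)
  averaged-bit avg bit = bounds⇒bit (averaged-≥ avg (λ b → bit-≥ ∘ bit b))
                                    (averaged-≤ avg (λ b → bit-≤ ∘ bit b))

module Hull {m n} {S : IMat m n → Set} (A : IMat m n) (A∈hull : InConvexHull S (toQ A)) where

  open Averaging (proj₁ (proj₂ A∈hull)) (proj₁ (proj₂ (proj₂ A∈hull))) A public

  entry-averaged : ∀ i j → Averaged (λ B → B i j)
  entry-averaged i j = averaged (proj₂ (proj₂ (proj₂ A∈hull)) i j)

  row-psum-averaged : ∀ i k → Averaged (λ B → psum k (B i))
  row-psum-averaged i k = averaged-psum k (entry-averaged i)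

  column-psum-averaged : ∀ j k → Averaged (λ B → psum k (λ i → B i j))
  column-psum-averaged j k = averaged-psum k (λ i → entry-averaged i j)

  row-sum-averaged : ∀ i → Averaged (λ B → sumℤ (B i))
  row-sum-averaged i = averaged-sumℤ (entry-averaged i)

  column-sum-averaged : ∀ j → Averaged (λ B → sumℤ (λ i → B i j))
  column-sum-averaged j = averaged-sumℤ (λ i → entry-averaged i j)

  signs : (∀ B → S B → ∀ i j → IsSign (B i j)) → ∀ i j → IsSign (A i j)
  signs sign i j = averaged-sign (entry-averaged i j) (λ B B∈S → sign B B∈S i j)

  signMatrix : (∀ B → S B → IsSignMatrix B) → IsSignMatrix A
  signMatrix sm =
    signs (λ B → proj₁ ∘ sm B) ,
    (λ j k → averaged-bit (column-psum-averaged j (suc (toℕ k))) (λ B B∈S → proj₁ (proj₂ (sm B B∈S)) j k)) ,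
    (λ i k → averaged-≥ (row-psum-averaged i (suc (toℕ k))) (λ B B∈S → proj₂ (proj₂ (sm B B∈S)) i k))

module _ {n} (v : Fin n → ℤ) where

  ZerosBetween : Fin n → ℕ → Set
  ZerosBetween l k = ∀ m → toℕ l < toℕ m → toℕ m < k → v m ≡ + 0

  Alternating : Set
  Alternating = ∀ j k → toℕ j < toℕ k → v j ≢ + 0 → v k ≢ + 0 → ZerosBetween j (toℕ k) → v j + v k ≡ + 0

  PrefixBits : Set
  PrefixBits = ∀ k → k ≤ n → Bit (psum k v)

  -- Under alternation every nonzero entry cancels the previous one, so the sum of a segment
  -- is 0 or its last nonzero entry.
  SegmentSumInvariant : ℕ → ℕ → Set
  SegmentSumInvariant j k =
    psum k v ≡ psum j v ⊎ Σ[ l ∈ Fin n ] toℕ l < k × ZerosBetween l k × psum k v ≡ psum j v + v l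

  zerosBetween-adjacent : ∀ p → ZerosBetween p (suc (toℕ p))
  zerosBetween-adjacent p m p<m m<1+p = ⊥-elim (ℕP.<⇒≱ p<m (ℕP.≤-pred m<1+p))

  zerosBetween-extend : ∀ {l} p → ZerosBetween l (toℕ p) → v p ≡ + 0 → ZerosBetween l (suc (toℕ p))
  zerosBetween-extend p zeros vp≡0 m l<m m<1+p with ℕP.m≤n⇒m<n∨m≡n (ℕP.≤-pred m<1+p)
  ... | inj₁ m<p = zeros m l<m m<p
  ... | inj₂ m≡p = trans (cong v (FinP.toℕ-injective m≡p)) vp≡0

  segmentSumInvariant-step : Alternating → ∀ {j} p →
                             SegmentSumInvariant j (toℕ p) → SegmentSumInvariant j (suc (toℕ p))
  segmentSumInvariant-step alt {j} p inv with v p ℤ.≟ + 0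
  ... | yes vp≡0 = skip inv
    where
    psum-unchanged : psum (suc (toℕ p)) v ≡ psum (toℕ p) v
    psum-unchanged = trans (psum-step v p) (trans (cong (_+_ (psum (toℕ p) v)) vp≡0) (ℤP.+-identityʳ _))
    skip : SegmentSumInvariant j (toℕ p) → SegmentSumInvariant j (suc (toℕ p))
    skip (inj₁ eq)                     = inj₁ (trans psum-unchanged eq)
    skip (inj₂ (l , l<p , zeros , eq)) =
      inj₂ (l , ℕP.m<n⇒m<1+n l<p , zerosBetween-extend p zeros vp≡0 , trans psum-unchanged eq)
  ... | no vp≢0 = take inv
    where
    start : psum (toℕ p) v ≡ psum j v → SegmentSumInvariant j (suc (toℕ p))
    start eq = inj₂ (p , ℕP.n<1+n (toℕ p) , zerosBetween-adjacent p ,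
                     trans (psum-step v p) (cong (_+ v p) eq))
    take : SegmentSumInvariant j (toℕ p) → SegmentSumInvariant j (suc (toℕ p))
    take (inj₁ eq) = start eq
    take (inj₂ (l , l<p , zeros , eq)) with v l ℤ.≟ + 0
    ... | yes vl≡0 = start (trans eq (trans (cong (_+_ (psum j v)) vl≡0) (ℤP.+-identityʳ _)))
    ... | no vl≢0  = inj₁ (begin
      psum (suc (toℕ p)) v        ≡⟨ psum-step v p ⟩
      psum (toℕ p) v + v p        ≡⟨ cong (_+ v p) eq ⟩
      (psum j v + v l) + v p      ≡⟨ ℤP.+-assoc (psum j v) (v l) (v p) ⟩
      psum j v + (v l + v p)      ≡⟨ cong (_+_ (psum j v)) (alt l p l<p vl≢0 vp≢0 zeros) ⟩
      psum j v + + 0              ≡⟨ ℤP.+-identityʳ (psum j v) ⟩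
      psum j v                    ∎)
      where open ≡-Reasoning

  segmentSumInvariant : Alternating → ∀ {j k} → j ≤ k → k ≤ n → SegmentSumInvariant j k
  segmentSumInvariant alt {k = zero}  z≤n _ = inj₁ refl
  segmentSumInvariant alt {j} {suc k} j≤1+k k<n with ℕP.m≤n⇒m<n∨m≡n j≤1+k
  ... | inj₂ refl      = inj₁ refl
  ... | inj₁ (s≤s j≤k) =
    subst (SegmentSumInvariant j ∘ suc) toℕ-p≡k
      (segmentSumInvariant-step alt p
        (subst (SegmentSumInvariant j) (sym toℕ-p≡k) (segmentSumInvariant alt j≤k (ℕP.<⇒≤ k<n))))
    where
    p : Fin n
    p = fromℕ< k<n
    toℕ-p≡k : toℕ p ≡ k
    toℕ-p≡k = FinP.toℕ-fromℕ< k<n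

  segmentSum-sign : (∀ i → IsSign (v i)) → Alternating → ∀ {j k} → j ≤ k → k ≤ n →
                    Σ[ s ∈ ℤ ] IsSign s × psum k v ≡ psum j v + s
  segmentSum-sign sign alt j≤k k≤n with segmentSumInvariant alt j≤k k≤n
  ... | inj₁ eq                 = + 0 , inj₂ (inj₁ refl) , trans eq (sym (ℤP.+-identityʳ _))
  ... | inj₂ (l , _ , _ , eq)   = v l , sign l , eq

bit-from-signs : ∀ {x s} → IsSign x → IsSign s → x + s ≡ + 1 → Bit x
bit-from-signs (inj₁ refl)        (inj₁ refl)        ()
bit-from-signs (inj₁ refl)        (inj₂ (inj₁ refl)) ()
bit-from-signs (inj₁ refl)        (inj₂ (inj₂ refl)) ()
bit-from-signs (inj₂ (inj₁ refl)) _                  _ = inj₁ refl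
bit-from-signs (inj₂ (inj₂ refl)) _                  _ = inj₂ refl

opposite-signs : ∀ {s a b} → Bit s → Bit (s + a + b) →
                 IsSign a → a ≢ + 0 → IsSign b → b ≢ + 0 → a + b ≡ + 0
opposite-signs _           _         (inj₂ (inj₁ refl)) a≢0 _                  _   = ⊥-elim (a≢0 refl)
opposite-signs _           _         _                  _   (inj₂ (inj₁ refl)) b≢0 = ⊥-elim (b≢0 refl)
opposite-signs _           _         (inj₁ refl)        _   (inj₂ (inj₂ refl)) _   = refl
opposite-signs _           _         (inj₂ (inj₂ refl)) _   (inj₁ refl)        _   = refl
opposite-signs (inj₁ refl) (inj₁ ()) (inj₁ refl)        _   (inj₁ refl)        _
opposite-signs (inj₁ refl) (inj₂ ()) (inj₁ refl)        _   (inj₁ refl)        _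
opposite-signs (inj₂ refl) (inj₁ ()) (inj₁ refl)        _   (inj₁ refl)        _
opposite-signs (inj₂ refl) (inj₂ ()) (inj₁ refl)        _   (inj₁ refl)        _
opposite-signs (inj₁ refl) (inj₁ ()) (inj₂ (inj₂ refl)) _   (inj₂ (inj₂ refl)) _
opposite-signs (inj₁ refl) (inj₂ ()) (inj₂ (inj₂ refl)) _   (inj₂ (inj₂ refl)) _
opposite-signs (inj₂ refl) (inj₁ ()) (inj₂ (inj₂ refl)) _   (inj₂ (inj₂ refl)) _
opposite-signs (inj₂ refl) (inj₂ ()) (inj₂ (inj₂ refl)) _   (inj₂ (inj₂ refl)) _

module _ {n} (v : Fin n → ℤ) (sign : ∀ i → IsSign (v i)) where

  -- The prefix sum and the complementary suffix sum are both signs and add up to 1.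
  alternating⇒prefixBits : Alternating v → sumℤ v ≡ + 1 → PrefixBits v
  alternating⇒prefixBits alt total k k≤n
    with segmentSum-sign v sign alt z≤n k≤n | segmentSum-sign v sign alt k≤n ℕP.≤-refl
  ... | s , s-sign , prefix | t , t-sign , suffix = bit-from-signs prefix-sign t-sign prefix+suffix
    where
    prefix-sign : IsSign (psum k v)
    prefix-sign = subst IsSign (sym (trans prefix (trans (cong (_+ s) (psum-zero v)) (ℤP.+-identityˡ s))))
                        s-sign
    prefix+suffix : psum k v + t ≡ + 1
    prefix+suffix = trans (sym suffix) (trans (psum-total v) total)

  prefixBits⇒alternating : PrefixBits v → Alternating v
  prefixBits⇒alternating bits j k j<k vj≢0 vk≢0 zeros =
    opposite-signs (bits (toℕ j) (ℕP.<⇒≤ (FinP.toℕ<n j)))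
                   (subst Bit psum-through-k (bits (suc (toℕ k)) (FinP.toℕ<n k)))
                   (sign j) vj≢0 (sign k) vk≢0
    where
    psum-through-k : psum (suc (toℕ k)) v ≡ psum (toℕ j) v + v j + v k
    psum-through-k = begin
      psum (suc (toℕ k)) v          ≡⟨ psum-step v k ⟩
      psum (toℕ k) v + v k          ≡⟨ cong (_+ v k) (psum-zeros v j<k zeros) ⟩
      psum (suc (toℕ j)) v + v k    ≡⟨ cong (_+ v k) (psum-step v j) ⟩
      psum (toℕ j) v + v j + v k    ∎
      where open ≡-Reasoning

module _ {n} {B : IMat n n} where

  asm-row-prefixBits : IsASM B → ∀ i → PrefixBits (B i)
  asm-row-prefixBits (sign , rowSums , _ , rowAlt , _) i =
    alternating⇒prefixBits (B i) (sign i) (rowAlt i) (rowSums i)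

  asm-column-prefixBits : IsASM B → ∀ j → PrefixBits (λ i → B i j)
  asm-column-prefixBits (sign , _ , columnSums , _ , columnAlt) j =
    alternating⇒prefixBits (λ i → B i j) (λ i → sign i j) (columnAlt j) (columnSums j)

hull⇒IsASM : ∀ {n} {A : IMat n n} → InASMpoly n (toQ A) → IsASM A
hull⇒IsASM {A = A} A∈hull = sign , rowSums , columnSums , rowAlt , columnAlt
  where
  open Hull A A∈hull
  sign : ∀ i j → IsSign (A i j)
  sign = signs (λ B → proj₁)
  rowSums : ∀ i → sumℤ (A i) ≡ + 1
  rowSums i = averaged-≡ (row-sum-averaged i) (λ B asm → proj₁ (proj₂ asm) i)
  columnSums : ∀ j → sumℤ (λ i → A i j) ≡ + 1
  columnSums j = averaged-≡ (column-sum-averaged j) (λ B asm → proj₁ (proj₂ (proj₂ asm)) j)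
  rowAlt : ∀ i → Alternating (A i)
  rowAlt i = prefixBits⇒alternating (A i) (sign i) λ k k≤n →
    averaged-bit (row-psum-averaged i k) (λ B asm → asm-row-prefixBits asm i k k≤n)
  columnAlt : ∀ j → Alternating (λ i → A i j)
  columnAlt j = prefixBits⇒alternating (λ i → A i j) (λ i → sign i j) λ k k≤n →
    averaged-bit (column-psum-averaged j k) (λ B asm → asm-column-prefixBits asm j k k≤n)

theorem8p11 :
    ((m n : ℕ) (A : IMat m n) → InP m n (toQ A) → IsSignMatrix A) ×
    ((λs : List ℕ) (n : ℕ) → IsPartition λs → 1 ≤ n →
      (A : IMat (largestPart λs) n) → InPλ λs n (toQ A) → InM λs n A) ×
    ((n : ℕ) (A : IMat n n) → InASMpoly n (toQ A) → IsASM A)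
theorem8p11 =
  (λ m n A A∈hull → Hull.signMatrix A A∈hull (λ B B∈S → B∈S)) ,
  (λ λs n _ _ A A∈hull → let open Hull A A∈hull in
     signMatrix (λ B → proj₁) , λ r → averaged-≡ (row-sum-averaged r) (λ B B∈M → proj₂ B∈M r)) ,
  (λ n A → hull⇒IsASM)
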